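{- Let $D$ be an oriented graph with $\operatorname{inv}(D)=1$. Then $\operatorname{inv}(\sigma(z,D)) = 2$ for every $z\in V(D)$.
   Context: An oriented graph is a digraph with no loops, no multiple arcs and no directed cycle of length 2. Inverting a vertex set $X$ means reversing every arc with both ends in $X$. $\operatorname{inv}(D)$ is the minimum number of successive inversions needed to make the oriented graph $D$ acyclic. For an oriented graph $D$ and $z\in V(D)$, the $z$-augmentation $\sigma(z,D)$ is obtained from $D$ by adding two new vertices $y$ and $x$, the arcs $zy$, $yx$, $xz$, and all arcs from $\{x,y\}$ to $V(D)\setminus\{z\}$. -}

module Defs where

open import Data.Nat using (ℕ; zero; suc; _<_)
open import Data.Fin using (Fin; zero; suc; _≟_)
open import Data.Bool using (Bool; true; false; _∧_; if_then_else_; not)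
open import Data.Vec using (Vec; []; _∷_; foldl)
open import Data.Product using (Σ; _×_; ∃)
open import Relation.Nullary using (¬_)
open import Relation.Nullary.Decidable using (⌊_⌋)
open import Relation.Binary.PropositionalEquality using (_≡_)

-- A digraph on vertex set Fin n, given by its (decidable) arc relation:
-- A u v ≡ true  iff  uv is an arc.  Simple by construction (no multiple arcs).
Digraph : ℕ → Set
Digraph n = Fin n → Fin n → Bool

record IsOriented {n : ℕ} (A : Digraph n) : Set where
  field
    noLoop   : ∀ u → A u u ≡ false
    no2cycle : ∀ u v → A u v ≡ true → A v u ≡ false

data Walk⁺ {n : ℕ} (A : Digraph n) : Fin n → Fin n → Set where
  arc  : ∀ {u v} → A u v ≡ true → Walk⁺ A u v
  step : ∀ {u v w} → A u v ≡ true → Walk⁺ A v w → Walk⁺ A u w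

Acyclic : ∀ {n} → Digraph n → Set
Acyclic A = ∀ v → ¬ Walk⁺ A v v

VSet : ℕ → Set
VSet n = Fin n → Bool

invert : ∀ {n} → Digraph n → VSet n → Digraph n
invert A X u v = if X u ∧ X v then A v u else A u v

invertAll : ∀ {n k} → Digraph n → Vec (VSet n) k → Digraph n
invertAll A Xs = foldl (λ _ → Digraph _) invert A Xs

InvertibleIn : ∀ {n} → Digraph n → ℕ → Set
InvertibleIn {n} A k = Σ (Vec (VSet n) k) λ Xs → Acyclic (invertAll A Xs)

InvIs : ∀ {n} → Digraph n → ℕ → Set
InvIs A k = InvertibleIn A k × (∀ j → j < k → ¬ InvertibleIn A j)

-- The z-augmentation σ(z,D) on Fin (2 + n):
-- vertex 0 is y, vertex 1 is x, vertex (suc (suc i)) is the old vertex i.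
-- Arcs: those of D, zy, yx, xz, and xv, yv for every old v ≠ z.
σ : ∀ {n} → Fin n → Digraph n → Digraph (suc (suc n))
σ z A zero          zero                = false
σ z A zero          (suc zero)          = true
σ z A zero          (suc (suc v))       = not ⌊ v ≟ z ⌋
σ z A (suc zero)    zero                = false
σ z A (suc zero)    (suc zero)          = false
σ z A (suc zero)    (suc (suc v))       = true
σ z A (suc (suc u)) zero                = ⌊ u ≟ z ⌋
σ z A (suc (suc u)) (suc zero)          = false
σ z A (suc (suc u)) (suc (suc v))       = A u v

-- The triangle z → y → x → z of σ(z,D) forces every acyclic inversion to meet it in
-- exactly two vertices. If x is inverted, an arc ab of D entering the inverted set
-- closes the cycle x → a → b → x; such an arc exists, since otherwise the single
-- inversion would already make D acyclic. If {y,z} is inverted but x is not, either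
-- another old vertex v is inverted, giving v → y → x → v, or the inversion leaves D
-- untouched. Conversely, after inverting a set that makes D acyclic and then {y,z},
-- the vertex y becomes a source and x a vertex whose only in-neighbour is y.
module Submission where

open import Defs
open import Data.Nat using (ℕ; zero; suc; _<_; z≤n; s≤s)
open import Data.Fin using (Fin; zero; suc; _≟_)
open import Data.Bool using (true; false; not)
open import Data.Vec using ([]; _∷_)
open import Data.Product using (_×_; _,_; ∃₂)
open import Data.Empty using (⊥; ⊥-elim)
open import Function using (id)
open import Relation.Nullary using (¬_; yes; no)
open import Relation.Nullary.Decidable using (⌊_⌋)
open import Relation.Binary.PropositionalEquality using (_≡_; refl; sym; trans; cong)

private variable
  n m : ℕ

true≢false : ¬ true ≡ false
true≢false ()

snoc : {A : Digraph n} {u v w : Fin n} → Walk⁺ A u v → A v w ≡ true → Walk⁺ A u w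
snoc (arc e)    e′ = step e (arc e′)
snoc (step e w) e′ = step e (snoc w e′)

Walk⁺-map : {A : Digraph n} {B : Digraph m} (f : Fin n → Fin m) →
  (∀ {a b} → A a b ≡ true → B (f a) (f b) ≡ true) →
  ∀ {u v} → Walk⁺ A u v → Walk⁺ B (f u) (f v)
Walk⁺-map f hom (arc e)    = arc (hom e)
Walk⁺-map f hom (step e w) = step (hom e) (Walk⁺-map f hom w)

acyclic-pullback : {A : Digraph n} {B : Digraph m} (f : Fin n → Fin m) →
  (∀ {a b} → A a b ≡ true → B (f a) (f b) ≡ true) → Acyclic B → Acyclic A
acyclic-pullback f hom acyclic v cycle = acyclic (f v) (Walk⁺-map f hom cycle)

deleteZero : Digraph (suc n) → Digraph n
deleteZero A u v = A (suc u) (suc v)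

module _ {A : Digraph (suc n)} (source : ∀ a → A a zero ≡ false) where

  no-walk-into-source : ∀ {a} → ¬ Walk⁺ A a zero
  no-walk-into-source {a} (arc e)  = true≢false (trans (sym e) (source a))
  no-walk-into-source (step _ w) = no-walk-into-source w

  walk-avoids-source : ∀ {u v} → Walk⁺ A (suc u) (suc v) → Walk⁺ (deleteZero A) u v
  walk-avoids-source (arc e)                = arc e
  walk-avoids-source (step {v = zero} e _)  = ⊥-elim (no-walk-into-source (arc e))
  walk-avoids-source (step {v = suc _} e w) = step e (walk-avoids-source w)

  acyclic-add-source : Acyclic (deleteZero A) → Acyclic A
  acyclic-add-source acyclic zero    cycle = no-walk-into-source cycle
  acyclic-add-source acyclic (suc v) cycle = acyclic v (walk-avoids-source cycle)

module _ (A : Digraph n) (X : VSet n) {u v : Fin n} where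

  invert-inside : X u ≡ true → X v ≡ true → invert A X u v ≡ A v u
  invert-inside p q rewrite p | q = refl

  invert-outsideˡ : X u ≡ false → invert A X u v ≡ A u v
  invert-outsideˡ p rewrite p = refl

  invert-outsideʳ : X v ≡ false → invert A X u v ≡ A u v
  invert-outsideʳ q with X u
  ... | true  rewrite q = refl
  ... | false = refl

  invert-subsingleton : (∀ {a b} → X a ≡ true → X b ≡ true → a ≡ b) → invert A X u v ≡ A u v
  invert-subsingleton sub with X u in p | X v in q
  ... | true  | true  with refl ← sub p q = refl
  ... | true  | false = refl
  ... | false | _     = refl

Enters : Digraph n → VSet n → Set
Enters {n} A X = ∃₂ λ (a b : Fin n) → A a b ≡ true × X a ≡ false × X b ≡ true

module _ (A : Digraph n) (X : VSet n) (closed : ¬ Enters A X) where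

  walk-never-enters : ∀ {u w} → Walk⁺ A u w → X u ≡ false → X w ≡ true → ⊥
  walk-never-enters {u} {w} (arc e) p q = closed (u , w , e , p , q)
  walk-never-enters {u} (step {v = v} e walk) p q with X v in r
  ... | true  = closed (u , v , e , p , r)
  ... | false = walk-never-enters walk r q

  walk-outside-kept : ∀ {u w} → Walk⁺ A u w → X u ≡ false → Walk⁺ (invert A X) u w
  walk-outside-kept {u} {w} (arc e) p with X w in q
  ... | true  = ⊥-elim (closed (u , w , e , p , q))
  ... | false = arc (trans (invert-outsideˡ A X p) e)
  walk-outside-kept {u} (step {v = v} e walk) p with X v in r
  ... | true  = ⊥-elim (closed (u , v , e , p , r))
  ... | false = step (trans (invert-outsideˡ A X p) e) (walk-outside-kept walk r)

  walk-inside-reversed : ∀ {u w} → Walk⁺ A u w → X u ≡ true → X w ≡ true → Walk⁺ (invert A X) w u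
  walk-inside-reversed (arc e) p q = arc (trans (invert-inside A X q p) e)
  walk-inside-reversed (step {v = v} e walk) p q with X v in r
  ... | true  = snoc (walk-inside-reversed walk r q) (trans (invert-inside A X r p) e)
  ... | false = ⊥-elim (walk-never-enters walk r q)

  acyclic-invert⇒acyclic : Acyclic (invert A X) → Acyclic A
  acyclic-invert⇒acyclic acyclic v cycle with X v in p
  ... | true  = acyclic v (walk-inside-reversed cycle p p)
  ... | false = acyclic v (walk-outside-kept cycle p)

⁅_⁆ : Fin n → VSet n
⁅ z ⁆ u = ⌊ u ≟ z ⌋

z∈⁅z⁆ : (z : Fin n) → ⁅ z ⁆ z ≡ true
z∈⁅z⁆ z with z ≟ z
... | yes _   = refl
... | no z≢z = ⊥-elim (z≢z refl)

module Augmentation {n} (z : Fin n) (D : Digraph n) where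

  y x : Fin (suc (suc n))
  y = zero
  x = suc zero

  old : Fin n → Fin (suc (suc n))
  old u = suc (suc u)

  σ-triangle : Walk⁺ (σ z D) (old z) (old z)
  σ-triangle = step {v = y} (z∈⁅z⁆ z) (step {v = x} refl (arc refl))

  σ-cyclic : ¬ Acyclic (σ z D)
  σ-cyclic acyclic = acyclic (old z) σ-triangle

  liftOld : VSet n → VSet (suc (suc n))
  liftOld X (suc (suc u)) = X u
  liftOld X _             = false

  ⁅y,z⁆ : VSet (suc (suc n))
  ⁅y,z⁆ (suc (suc u)) = ⁅ z ⁆ u
  ⁅y,z⁆ (suc zero)    = false
  ⁅y,z⁆ zero          = true

  module _ (X : VSet n) where

    F : Digraph (suc (suc n))
    F = invert (invert (σ z D) (liftOld X)) ⁅y,z⁆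

    y-source : ∀ a → F a y ≡ false
    y-source zero       = refl
    y-source (suc zero) = refl
    y-source (suc (suc u)) with u ≟ z
    ... | yes refl = refl
    ... | no _ with X u
    ...   | true  = refl
    ...   | false = refl

    x-source-after-y : ∀ a → deleteZero F a zero ≡ false
    x-source-after-y zero = refl
    x-source-after-y (suc u) with u ≟ z | X u
    ... | yes refl | true  = refl
    ... | yes refl | false = refl
    ... | no _     | true  = refl
    ... | no _     | false = refl

    -- On the old vertices F is invert D X followed by the inversion of {z}.
    invertible-in-two : Acyclic (invert D X) → InvertibleIn (σ z D) 2
    invertible-in-two acyclic =
      liftOld X ∷ ⁅y,z⁆ ∷ [] ,
      acyclic-add-source y-source (acyclic-add-source x-source-after-y
        (acyclic-pullback id (λ e → trans (sym (invert-subsingleton (invert D X) ⁅ z ⁆ z-unique)) e) acyclic))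
      where
      z-unique : ∀ {a b} → ⁅ z ⁆ a ≡ true → ⁅ z ⁆ b ≡ true → a ≡ b
      z-unique {a} {b} p q with a ≟ z | b ≟ z
      ... | yes refl | yes refl = refl

  module _ (D-cyclic : ¬ Acyclic D) (X : VSet (suc (suc n))) (acyclic : Acyclic (invert (σ z D) X)) where

    private
      H : Digraph (suc (suc n))
      H = invert (σ z D) X

      Xold : VSet n
      Xold u = X (old u)

    old-acyclic : Acyclic (invert D Xold)
    old-acyclic = acyclic-pullback old id acyclic

    some-arc-enters : ¬ ¬ Enters D Xold
    some-arc-enters closed = D-cyclic (acyclic-invert⇒acyclic D Xold closed old-acyclic)

    x-not-inverted : ¬ X x ≡ true
    x-not-inverted x∈X = some-arc-enters λ (a , b , ab , a∉X , b∈X) →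
      acyclic x (step (invert-outsideʳ (σ z D) X a∉X)
                (step (trans (invert-outsideˡ (σ z D) X a∉X) ab)
                (arc (invert-inside (σ z D) X b∈X x∈X))))

    module _ (x∉X : X x ≡ false) where

      zy-reversed : ¬ H (old z) y ≡ true
      zy-reversed zy = acyclic (old z)
        (step zy (step (invert-outsideʳ (σ z D) X x∉X) (arc (invert-outsideˡ (σ z D) X x∉X))))

      only-z-inverted : ∀ {v} → Xold v ≡ true → X y ≡ true → v ≡ z
      only-z-inverted {v} v∈X y∈X with v ≟ z in v≟z
      ... | yes v≡z = v≡z
      ... | no v≢z = ⊥-elim (acyclic (old v)
        (step (trans (invert-inside (σ z D) X v∈X y∈X) (cong (λ d → not ⌊ d ⌋) v≟z))
        (step (invert-outsideʳ (σ z D) X x∉X) (arc (invert-outsideˡ (σ z D) X x∉X)))))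

      y-not-inverted : ¬ X y ≡ true
      y-not-inverted y∈X = D-cyclic (acyclic-pullback old
        (λ e → trans (invert-subsingleton D Xold λ p q →
                        trans (only-z-inverted p y∈X) (sym (only-z-inverted q y∈X))) e)
        acyclic)

    not-invertible-in-one : ⊥
    not-invertible-in-one with X x in x∈X
    ... | true  = x-not-inverted x∈X
    ... | false with X y in y∈X
    ...   | true  = y-not-inverted x∈X y∈X
    ...   | false = zy-reversed x∈X (trans (invert-outsideʳ (σ z D) X y∈X) (z∈⁅z⁆ z))

lemma4p1 : (n : ℕ) (D : Digraph n) → IsOriented D → InvIs D 1 →
    (z : Fin n) → InvIs (σ z D) 2
lemma4p1 n D _ ((X ∷ [] , acyclic) , minimal) z =
  invertible-in-two X acyclic , not-invertible-below-two
  where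
  open Augmentation z D

  D-cyclic : ¬ Acyclic D
  D-cyclic acyclicD = minimal 0 (s≤s z≤n) ([] , acyclicD)

  not-invertible-below-two : ∀ j → j < 2 → ¬ InvertibleIn (σ z D) j
  not-invertible-below-two 0 _ ([] , acyclicσ)      = σ-cyclic acyclicσ
  not-invertible-below-two 1 _ (Y ∷ [] , acyclicσ) = not-invertible-in-one D-cyclic Y acyclicσ
  not-invertible-below-two (suc (suc _)) (s≤s (s≤s ()))
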